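{- There exists a bipartite Helly graph that does not satisfy the pairing property, and there exists a bipartite Helly graph that does not satisfy the double-pairing property.
   Context: Graphs are undirected, simple and connected; $d$ is the graph distance, $B_r(v)=\{x:d(v,x)\le r\}$. A bipartite graph with color classes $X,Y$ is a bipartite Helly graph if the family of half-balls $B_r(v)\cap X$, $B_r(v)\cap Y$ has the Helly property (every finite pairwise intersecting subfamily has nonempty intersection). A profile is a finite sequence of vertices (repetitions allowed); $\pi^2$ is $\pi$ concatenated with itself; $F_\pi(v)=\sum_{x\in\pi}d(v,x)$. For a profile of even length $2n$, a pairing $P$ is a partition of $\pi$ into $n$ pairs and $D_\pi(P)=\sum_{\{a,b\}\in P}d(a,b)$; $P$ is perfect if $D_\pi(P)=F_\pi(v)$ for some vertex $v$. $G$ has the pairing property if every profile of even length admits a perfect pairing, and the double-pairing property if for every profile $\pi$, $\pi^2$ admits a perfect pairing. -}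

module Defs where

open import Data.Nat using (ℕ; zero; suc; _+_; _≤_)
open import Data.Fin using (Fin)
open import Data.Bool using (Bool; true; false)
open import Data.Product using (Σ; ∃; ∃-syntax; _×_; _,_)
open import Data.List using (List; []; _∷_; _++_; map; length; foldr)
open import Data.Nat.ListAction using (sum)
open import Data.List.Membership.Propositional using (_∈_)
open import Data.List.Relation.Binary.Permutation.Propositional using (_↭_)
open import Relation.Binary.PropositionalEquality using (_≡_; _≢_)
open import Relation.Nullary using (¬_)

data Walk {n : ℕ} (adj : Fin n → Fin n → Bool) : Fin n → Fin n → ℕ → Set where
  nil  : ∀ {u} → Walk adj u u zero
  cons : ∀ {u w v k} → adj u w ≡ true → Walk adj w v k → Walk adj u v (suc k)

IsDist : {n : ℕ} → (Fin n → Fin n → Bool) → Fin n → Fin n → ℕ → Set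
IsDist adj u v k = Walk adj u v k × (∀ m → Walk adj u v m → k ≤ m)

-- A finite, simple, undirected, connected bipartite graph, together with its
-- (uniquely determined) distance function and a proper 2-colouring
-- (colour classes X = col⁻¹ true, Y = col⁻¹ false).
record BipartiteGraph : Set where
  field
    n         : ℕ
    adj       : Fin n → Fin n → Bool
    adj-sym   : ∀ u v → adj u v ≡ adj v u
    adj-irr   : ∀ u → adj u u ≡ false
    connected : ∀ u v → ∃[ k ] Walk adj u v k
    dist      : Fin n → Fin n → ℕ
    dist-spec : ∀ u v → IsDist adj u v (dist u v)
    col       : Fin n → Bool
    col-ok    : ∀ u v → adj u v ≡ true → col u ≢ col v

module _ (G : BipartiteGraph) where
  open BipartiteGraph G

  -- Half-ball B_r(v) ∩ (colour class c), indexed by (v , r , c).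
  HalfBallIndex : Set
  HalfBallIndex = Fin n × ℕ × Bool

  InHalfBall : HalfBallIndex → Fin n → Set
  InHalfBall (v , r , c) x = dist v x ≤ r × col x ≡ c

  BipartiteHelly : Set
  BipartiteHelly =
    ∀ (fam : List HalfBallIndex) →
    (∀ i j → i ∈ fam → j ∈ fam → ∃[ x ] (InHalfBall i x × InHalfBall j x)) →
    ∃[ x ] (∀ i → i ∈ fam → InHalfBall i x)

  Profile : Set
  Profile = List (Fin n)

  F : Profile → Fin n → ℕ
  F π v = sum (map (dist v) π)

  flatten : List (Fin n × Fin n) → List (Fin n)
  flatten = foldr (λ { (a , b) rest → a ∷ b ∷ rest }) []

  IsPairing : Profile → List (Fin n × Fin n) → Set
  IsPairing π P = flatten P ↭ π

  D : List (Fin n × Fin n) → ℕ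
  D P = sum (map (λ { (a , b) → dist a b }) P)

  IsPerfect : Profile → List (Fin n × Fin n) → Set
  IsPerfect π P = ∃[ v ] (D P ≡ F π v)

  PairingProperty : Set
  PairingProperty =
    ∀ (π : Profile) → (∃[ m ] (length π ≡ m + m)) →
    ∃[ P ] (IsPairing π P × IsPerfect π P)

  DoublePairingProperty : Set
  DoublePairingProperty =
    ∀ (π : Profile) → ∃[ P ] (IsPairing (π ++ π) P × IsPerfect (π ++ π) P)

-- K₃,₃ is a counterexample to both properties. In a complete bipartite graph
-- every half-ball is either a whole colour class or lies inside {v}, which
-- makes the half-balls Helly. All distances are at most 2, so a pairing of a
-- profile π costs at most |π|; but for π the six vertices of K₃,₃ every vertex
-- has F π v = 7 > 6, and F (π ++ π) v = 14 > 12.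
module Submission where

open import Defs
open import Data.Bool using (Bool; true; false; not; _xor_)
open import Data.Bool.Properties using (xor-comm; xor-same; xor-inverseˡ; not-¬; ¬-not)
  renaming (_≟_ to _≟ᵇ_)
open import Data.Fin using (Fin; toℕ; #_; _≟_)
open import Data.Fin.Properties using (all?)
open import Data.List using (List; []; _∷_; _++_; map; length; allFin)
open import Data.List.Properties using (map-++; length-++)
open import Data.List.Membership.Propositional using (find)
open import Data.List.Relation.Binary.Permutation.Propositional.Properties using (↭-length)
open import Data.List.Relation.Unary.All as All using (All; []; _∷_)
open import Data.List.Relation.Unary.Any using (Any; here; there)
open import Data.Nat using (ℕ; zero; suc; _+_; _≤_; _<_; _<ᵇ_; _<?_; z≤n; s≤s)
open import Data.Nat.ListAction using (sum)
open import Data.Nat.ListAction.Properties using (sum-++)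
open import Data.Nat.Properties using (≤-refl; ≤-reflexive; ≤-trans; +-mono-≤; +-mono-<; <⇒≱)
open import Data.Product using (∃-syntax; _×_; _,_)
open import Data.Sum using (_⊎_; inj₁; inj₂)
open import Relation.Binary.PropositionalEquality
  using (_≡_; _≢_; refl; sym; trans; subst; cong)
open import Relation.Nullary using (¬_; yes; no; contradiction)
open import Relation.Nullary.Decidable using (toWitness)

xor≡true⇒≢ : ∀ {x y} → x xor y ≡ true → x ≢ y
xor≡true⇒≢ {x} x⊕x≡true refl = contradiction (trans (sym (xor-same x)) x⊕x≡true) λ ()

≢⇒xor≡true : ∀ {x y} → x ≢ y → x xor y ≡ true
≢⇒xor≡true {x} {y} x≢y rewrite ¬-not x≢y = xor-inverseˡ y

all⊎any : ∀ {A : Set} {P Q : A → Set} → (∀ x → P x ⊎ Q x) →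
          ∀ xs → All P xs ⊎ Any Q xs
all⊎any P⊎Q [] = inj₁ []
all⊎any P⊎Q (x ∷ xs) with P⊎Q x | all⊎any P⊎Q xs
... | inj₂ qx | _       = inj₂ (here qx)
... | inj₁ _  | inj₂ qs = inj₂ (there qs)
... | inj₁ px | inj₁ ps = inj₁ (px ∷ ps)

module CompleteBipartite {n : ℕ} (col : Fin n → Bool)
                         (colour-classes-nonempty : ∀ c → ∃[ v ] col v ≡ c) where

  adj : Fin n → Fin n → Bool
  adj u v = col u xor col v

  dist : Fin n → Fin n → ℕ
  dist u v with u ≟ v | col u ≟ᵇ col v
  ... | yes _ | _     = 0
  ... | no _  | yes _ = 2
  ... | no _  | no _  = 1

  dist≤2 : ∀ u v → dist u v ≤ 2
  dist≤2 u v with u ≟ v | col u ≟ᵇ col v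
  ... | yes _ | _     = z≤n
  ... | no _  | yes _ = ≤-refl
  ... | no _  | no _  = s≤s z≤n

  dist-self : ∀ u → dist u u ≡ 0
  dist-self u with u ≟ u
  ... | yes _  = refl
  ... | no u≢u = contradiction refl u≢u

  dist≤0⇒≡ : ∀ {u v} → dist u v ≤ 0 → u ≡ v
  dist≤0⇒≡ {u} {v} d≤0 with u ≟ v | col u ≟ᵇ col v | d≤0
  ... | yes u≡v | _     | _  = u≡v
  ... | no _    | yes _ | ()
  ... | no _    | no _  | ()

  dist-≢col : ∀ {u v} → col u ≢ col v → dist u v ≡ 1
  dist-≢col {u} {v} cu≢cv with u ≟ v | col u ≟ᵇ col v
  ... | yes refl | _         = contradiction refl cu≢cv
  ... | no _     | yes cu≡cv = contradiction cu≡cv cu≢cv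
  ... | no _     | no _      = refl

  dist≤1-≡col⇒≡ : ∀ {u v} → col u ≡ col v → dist u v ≤ 1 → u ≡ v
  dist≤1-≡col⇒≡ {u} {v} cu≡cv d≤1 with u ≟ v | col u ≟ᵇ col v | d≤1
  ... | yes u≡v | _        | _      = u≡v
  ... | no _    | yes _    | s≤s ()
  ... | no _    | no cu≢cv | _      = contradiction cu≡cv cu≢cv

  shortest-walk : ∀ u v → Walk adj u v (dist u v)
  shortest-walk u v with u ≟ v | col u ≟ᵇ col v
  ... | yes refl | _        = nil
  ... | no _     | no cu≢cv = cons (≢⇒xor≡true cu≢cv) nil
  ... | no _     | yes cu≡cv
    with w , cw≡¬cu ← colour-classes-nonempty (not (col u))
    = cons (≢⇒xor≡true cu≢cw) (cons (≢⇒xor≡true cw≢cv) nil)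
    where
    cu≢cw : col u ≢ col w
    cu≢cw cu≡cw = not-¬ refl (trans cu≡cw cw≡¬cu)
    cw≢cv : col w ≢ col v
    cw≢cv cw≡cv = cu≢cw (trans cu≡cv (sym cw≡cv))

  dist-minimal : ∀ {u v} m → Walk adj u v m → dist u v ≤ m
  dist-minimal {u} zero nil = ≤-reflexive (dist-self u)
  dist-minimal 1 (cons e nil) = ≤-reflexive (dist-≢col (xor≡true⇒≢ e))
  dist-minimal {u} {v} (suc (suc m)) _ = ≤-trans (dist≤2 u v) (s≤s (s≤s z≤n))

  graph : BipartiteGraph
  graph = record
    { n         = n
    ; adj       = adj
    ; adj-sym   = λ u v → xor-comm (col u) (col v)
    ; adj-irr   = λ u → xor-same (col u)
    ; connected = λ u v → dist u v , shortest-walk u v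
    ; dist      = dist
    ; dist-spec = λ u v → shortest-walk u v , dist-minimal
    ; col       = col
    ; col-ok    = λ _ _ → xor≡true⇒≢
    }

  Spanning : HalfBallIndex graph → Set
  Spanning i@(_ , _ , c) = ∀ x → col x ≡ c → InHalfBall graph i x

  WithinCentre : HalfBallIndex graph → Set
  WithinCentre i@(v , _ , _) = ∀ x → InHalfBall graph i x → x ≡ v

  halfBall-dichotomy : ∀ i → Spanning i ⊎ WithinCentre i
  halfBall-dichotomy (v , zero , c) = inj₂ λ x (d≤0 , _) → sym (dist≤0⇒≡ d≤0)
  halfBall-dichotomy (v , suc (suc r) , c) =
    inj₁ λ x cx≡c → ≤-trans (dist≤2 v x) (s≤s (s≤s z≤n)) , cx≡c
  halfBall-dichotomy (v , 1 , c) with col v ≟ᵇ c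
  ... | yes cv≡c = inj₂ λ x (d≤1 , cx≡c) → sym (dist≤1-≡col⇒≡ (trans cv≡c (sym cx≡c)) d≤1)
  ... | no cv≢c  = inj₁ λ x cx≡c →
    ≤-reflexive (dist-≢col λ cv≡cx → cv≢c (trans cv≡cx cx≡c)) , cx≡c

  helly : BipartiteHelly graph
  helly [] _ = let v , _ = colour-classes-nonempty true in v , λ _ ()
  helly fam@(i₀ ∷ _) pairwise with all⊎any halfBall-dichotomy fam
  ... | inj₂ some-within
    with j@(v , _ , _) , j∈ , within ← find some-within
    = v , λ k k∈ → let y , y∈j , y∈k = pairwise j k j∈ k∈
                   in subst (InHalfBall graph k) (within y y∈j) y∈k
  ... | inj₁ all-spanning
    with x , (_ , cx≡c₀) , _ ← pairwise i₀ i₀ (here refl) (here refl)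
    = x , λ k@(_ , _ , c) k∈ → let _ , (_ , cy≡c₀) , (_ , cy≡c) = pairwise i₀ k (here refl) k∈
                               in All.lookup all-spanning k∈ x (trans cx≡c₀ (trans (sym cy≡c₀) cy≡c))

module _ (G : BipartiteGraph) (diameter≤2 : ∀ u v → BipartiteGraph.dist G u v ≤ 2) where

  D≤length-flatten : ∀ P → D G P ≤ length (flatten G P)
  D≤length-flatten [] = z≤n
  D≤length-flatten ((a , b) ∷ P) = +-mono-≤ (diameter≤2 a b) (D≤length-flatten P)

  pairing-cost≤length : ∀ {π P} → IsPairing G π P → D G P ≤ length π
  pairing-cost≤length {π} {P} pairing =
    subst (D G P ≤_) (↭-length {xs = flatten G P} {ys = π} pairing) (D≤length-flatten P)

  no-perfect-pairing : ∀ {π} → (∀ v → length π < F G π v) →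
                       ¬ (∃[ P ] (IsPairing G π P × IsPerfect G π P))
  no-perfect-pairing {π} long (P , pairing , v , D≡F) =
    <⇒≱ (long v) (subst (_≤ length π) D≡F (pairing-cost≤length {π} {P} pairing))

module _ (G : BipartiteGraph) where

  F-++ : ∀ π ρ v → F G (π ++ ρ) v ≡ F G π v + F G ρ v
  F-++ π ρ v = trans (cong sum (map-++ _ π ρ)) (sum-++ (map _ π) (map _ ρ))

  doubling-keeps-F>length : ∀ {π} → (∀ v → length π < F G π v) →
                            ∀ v → length (π ++ π) < F G (π ++ π) v
  doubling-keeps-F>length {π} long v
    rewrite length-++ π {π} | F-++ π π v = +-mono-< (long v) (long v)

colour₃₃ : Fin 6 → Bool
colour₃₃ v = toℕ v <ᵇ 3

colour₃₃-classes-nonempty : ∀ c → ∃[ v ] colour₃₃ v ≡ c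
colour₃₃-classes-nonempty true  = # 0 , refl
colour₃₃-classes-nonempty false = # 5 , refl

open CompleteBipartite colour₃₃ colour₃₃-classes-nonempty
  renaming (graph to K₃₃; helly to K₃₃-helly; dist≤2 to K₃₃-diameter≤2)

vertices : List (Fin 6)
vertices = allFin 6

F-vertices>length : ∀ v → length vertices < F K₃₃ vertices v
F-vertices>length = toWitness {a? = all? λ v → length vertices <? F K₃₃ vertices v} _

proposition31 : (∃[ G ] (BipartiteHelly G × ¬ PairingProperty G))
                × (∃[ G ] (BipartiteHelly G × ¬ DoublePairingProperty G))
proposition31 = (K₃₃ , K₃₃-helly , ¬pairing) , (K₃₃ , K₃₃-helly , ¬double-pairing)
  where
  ¬pairing : ¬ PairingProperty K₃₃
  ¬pairing pairing = no-perfect-pairing K₃₃ K₃₃-diameter≤2 F-vertices>length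
                       (pairing vertices (3 , refl))

  ¬double-pairing : ¬ DoublePairingProperty K₃₃
  ¬double-pairing double-pairing =
    no-perfect-pairing K₃₃ K₃₃-diameter≤2 (doubling-keeps-F>length K₃₃ {vertices} F-vertices>length)
      (double-pairing vertices)
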